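{- Assume that $d_n^2 < 2p_n$ for every integer $n\geq 1$ with $n\neq 4$. For an integer $n\geq 1$ let $f(n) := n(n+1)/2$. Then $$\pi(n^3) < \pi(n^3+f(n)) < \pi(n^3+2f(n)) < \pi(n^3+4f(n)) < \pi(n^3+6f(n)),$$ and in particular there are at least four primes between $n^3$ and $(n+1)^3$.
   Context: $p_n$ denotes the $n$th prime ($p_1=2$), $d_n := p_{n+1}-p_n$, and $\pi(x)$ is the number of primes $p\leq x$. -}

module Defs where

open import Data.Nat using (ℕ; zero; suc; _+_; _*_; _/_)
open import Data.Nat.Primality using (Prime; prime?)
open import Data.Product using (_×_)
open import Relation.Nullary using (yes; no)
open import Relation.Binary.PropositionalEquality using (_≡_)

π : ℕ → ℕ
π zero = 0
π (suc x) with prime? (suc x)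
... | yes _ = suc (π x)
... | no  _ = π x

-- IsNthPrime n p  ⟺  p = p_n  (p is prime and exactly n primes are ≤ p), p_1 = 2
IsNthPrime : ℕ → ℕ → Set
IsNthPrime n p = Prime p × π p ≡ n

f : ℕ → ℕ
f n = (n * suc n) / 2

{-# OPTIONS --safe #-}
module Submission where

-- Let x ≥ 11, so that k = π x ≥ 5, and let p = p_k ≤ x < p_{k+1} = q.  The hypothesis gives
-- (q − p)² < 2p ≤ 2x, so whenever 2x ≤ d² we get q < p + d ≤ x + d, i.e. a prime in (x, x + d].
-- With N = n³ and m = f n, the inequality 2(N + m) ≤ m², true for n ≥ 7, makes d = m admissible
-- at x = N and x = N + m, and d = 2m admissible at x = N + 2m and x = N + 4m.  As
-- (n + 1)³ = N + 6m + 1 this yields the four primes; the cases n ≤ 6 are checked by computation.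

open import Defs
open import Data.Nat using (ℕ; zero; suc; _+_; _*_; _^_; _∸_; _<_; _≤_; z≤n; s≤s; _≤′_; ≤′-refl; ≤′-step; _!; _/_; _<?_; _≤?_)
open import Data.Nat.Properties
open import Data.Nat.Divisibility using (_∣_; ∣-trans; m∣m*n; m≤n⇒m!∣n!; ∣m+n∣m⇒∣n; ∣1⇒≡1)
open import Data.Nat.DivMod using (m*n/n≡m)
open import Data.Nat.Primality using (Prime; prime?; ¬prime[0]; ¬prime[1])
open import Data.Nat.Primality.Factorisation using (factorise)
open import Data.Nat.ListAction.Properties using (∈⇒∣product)
open import Data.Nat.Tactic.RingSolver using (solve-∀)
open import Data.List using ([]; _∷_)
open import Data.List.Relation.Unary.All using (_∷_)
open import Data.List.Relation.Unary.Any using (here)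
open import Data.Product using (_×_; _,_; ∃-syntax)
open import Data.Empty using (⊥-elim)
open import Relation.Nullary using (¬_; yes; no)
open import Relation.Nullary.Decidable using (True; toWitness)
open import Relation.Binary.PropositionalEquality using (_≡_; refl; sym; trans; cong; subst; module ≡-Reasoning)

π-suc-prime : ∀ x → Prime (suc x) → π (suc x) ≡ suc (π x)
π-suc-prime x p with prime? (suc x)
... | yes _ = refl
... | no ¬p = ⊥-elim (¬p p)

π-suc-nonprime : ∀ x → ¬ Prime (suc x) → π (suc x) ≡ π x
π-suc-nonprime x ¬p with prime? (suc x)
... | yes p = ⊥-elim (¬p p)
... | no _  = refl

π-≤-suc : ∀ x → π x ≤ π (suc x)
π-≤-suc x with prime? (suc x)
... | yes _ = n≤1+n _
... | no _  = ≤-refl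

π-mono-≤ : ∀ {x y} → x ≤ y → π x ≤ π y
π-mono-≤ {x} x≤y = go (≤⇒≤′ x≤y)
  where
  go : ∀ {y} → x ≤′ y → π x ≤ π y
  go ≤′-refl            = ≤-refl
  go (≤′-step {y} x≤′y) = ≤-trans (go x≤′y) (π-≤-suc y)

greatest-prime-≤ : ∀ x → 1 ≤ π x → ∃[ p ] p ≤ x × IsNthPrime (π x) p
greatest-prime-≤ (suc x) h with prime? (suc x)
... | yes p = suc x , ≤-refl , p , π-suc-prime x p
... | no _ with greatest-prime-≤ x h
...   | p , p≤x , isNth = p , m≤n⇒m≤1+n p≤x , isNth

∃-prime-divisor : ∀ n → 1 < n → ∃[ p ] Prime p × p ∣ n
∃-prime-divisor n@(suc _) 1<n with factorise n
... | record { factors = [] ; isFactorisation = n≡1 } = ⊥-elim (<⇒≢ 1<n (sym n≡1))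
... | record { factors = p ∷ ps ; isFactorisation = n≡∏ ; factorsPrime = prime-p ∷ _ } =
  p , prime-p , subst (p ∣_) (sym n≡∏) (∈⇒∣product {ns = p ∷ ps} (here refl))

∣-factorial : ∀ {p x} → 1 ≤ p → p ≤ x → p ∣ x !
∣-factorial {suc p} _ p≤x = ∣-trans (m∣m*n (p !)) (m≤n⇒m!∣n! p≤x)

∃-prime-> : ∀ x → ∃[ q ] x < q × Prime q
∃-prime-> x with ∃-prime-divisor (x ! + 1) (+-monoˡ-≤ 1 (1≤n! x))
... | q , prime-q , q∣x!+1 with q ≤? x
...   | no  q≰x = q , ≰⇒> q≰x , prime-q
...   | yes q≤x = ⊥-elim (¬prime[1] (subst Prime q≡1 prime-q))
  where
  q≡1 : q ≡ 1
  q≡1 = ∣1⇒≡1 (∣m+n∣m⇒∣n q∣x!+1 (∣-factorial (n≢0⇒n>0 λ { refl → ¬prime[0] prime-q }) q≤x))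

next-prime-within : ∀ k x → Prime (suc (k + x)) → ∃[ q ] x < q × IsNthPrime (suc (π x)) q
next-prime-within zero x p = suc x , ≤-refl , p , π-suc-prime x p
next-prime-within (suc k) x p with prime? (suc x)
... | yes p′ = suc x , ≤-refl , p′ , π-suc-prime x p′
... | no ¬p with next-prime-within k (suc x) (subst Prime (cong suc (sym (+-suc k x))) p)
...   | q , x<q , prime-q , πq≡ =
  q , <-trans (n<1+n x) x<q , prime-q , trans πq≡ (cong suc (π-suc-nonprime x ¬p))

next-prime : ∀ x → ∃[ q ] x < q × IsNthPrime (suc (π x)) q
next-prime x with ∃-prime-> x
... | r , x<r , prime-r = next-prime-within (r ∸ suc x) x (subst Prime (sym r≡) prime-r)
  where
  r≡ : suc (r ∸ suc x + x) ≡ r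
  r≡ = trans (sym (+-suc (r ∸ suc x) x)) (m∸n+n≡m x<r)

PrimeGapBound : Set
PrimeGapBound = ∀ (k p q : ℕ) → 1 ≤ k → ¬ (k ≡ 4) → IsNthPrime k p → IsNthPrime (suc k) q →
  (q ∸ p) ^ 2 < 2 * p

^2-cancel-< : ∀ {m n} → m ^ 2 < n ^ 2 → m < n
^2-cancel-< m²<n² = ≰⇒> λ n≤m → <⇒≱ m²<n² (^-monoˡ-≤ 2 n≤m)

π<π[x+d] : PrimeGapBound → ∀ {x d} → 1 ≤ π x → ¬ (π x ≡ 4) → 2 * x ≤ d ^ 2 → π x < π (x + d)
π<π[x+d] gap {x} {d} 1≤πx πx≢4 2x≤d² with greatest-prime-≤ x 1≤πx | next-prime x
... | p , p≤x , p-isNth | q , _ , q-isNth@(_ , πq≡) = subst (_≤ π (x + d)) πq≡ (π-mono-≤ q≤x+d)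
  where
  q∸p<d : q ∸ p < d
  q∸p<d = ^2-cancel-< (<-≤-trans (gap (π x) p q 1≤πx πx≢4 p-isNth q-isNth)
                                  (≤-trans (*-monoʳ-≤ 2 p≤x) 2x≤d²))
  q≤x+d : q ≤ x + d
  q≤x+d = ≤-trans (m≤n+m∸n q p) (+-mono-≤ p≤x (<⇒≤ q∸p<d))

triangular : ℕ → ℕ
triangular zero    = 0
triangular (suc n) = suc n + triangular n

n*[1+n]≡triangular*2 : ∀ n → n * suc n ≡ triangular n * 2
n*[1+n]≡triangular*2 zero    = refl
n*[1+n]≡triangular*2 (suc n) = begin
  suc n * suc (suc n)              ≡⟨ expand n ⟩
  suc n * 2 + n * suc n            ≡⟨ cong (suc n * 2 +_) (n*[1+n]≡triangular*2 n) ⟩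
  suc n * 2 + triangular n * 2     ≡⟨ *-distribʳ-+ 2 (suc n) (triangular n) ⟨
  (suc n + triangular n) * 2       ∎
  where
  open ≡-Reasoning
  expand : ∀ n → (1 + n) * (2 + n) ≡ (1 + n) * 2 + n * (1 + n)
  expand = solve-∀

2*f≡n*[1+n] : ∀ n → 2 * f n ≡ n * suc n
2*f≡n*[1+n] n = begin
  2 * ((n * suc n) / 2)            ≡⟨ cong (λ t → 2 * (t / 2)) (n*[1+n]≡triangular*2 n) ⟩
  2 * (triangular n * 2 / 2)       ≡⟨ cong (2 *_) (m*n/n≡m (triangular n) 2) ⟩
  2 * triangular n                 ≡⟨ *-comm 2 (triangular n) ⟩
  triangular n * 2                 ≡⟨ n*[1+n]≡triangular*2 n ⟨
  n * suc n                        ∎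
  where open ≡-Reasoning

[2*m]²≡4*m² : ∀ m → (2 * m) ^ 2 ≡ 4 * m ^ 2
[2*m]²≡4*m² = expanded
  where
  expanded : ∀ m → (2 * m) * ((2 * m) * 1) ≡ 4 * (m * (m * 1))
  expanded = solve-∀

[1+n]³∸1≡n³+6f : ∀ n → suc n ^ 3 ∸ 1 ≡ n ^ 3 + 6 * f n
[1+n]³∸1≡n³+6f n = begin
  suc n ^ 3 ∸ 1                     ≡⟨ cong (_∸ 1) (expand n) ⟩
  n ^ 3 + 3 * (n * suc n)           ≡⟨ cong (λ t → n ^ 3 + 3 * t) (2*f≡n*[1+n] n) ⟨
  n ^ 3 + 3 * (2 * f n)             ≡⟨ cong (n ^ 3 +_) (*-assoc 3 2 (f n)) ⟨
  n ^ 3 + 6 * f n                   ∎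
  where
  open ≡-Reasoning
  expand : ∀ n → (1 + n) * ((1 + n) * ((1 + n) * 1)) ≡ 1 + (n * (n * (n * 1)) + 3 * (n * (1 + n)))
  expand = solve-∀

-- Substituting n = 7 + k leaves a difference with nonnegative coefficients in k.
8*n³+4*n*[1+n]≤[n*[1+n]]² : ∀ n → 7 ≤ n → 8 * n ^ 3 + 4 * (n * suc n) ≤ (n * suc n) ^ 2
8*n³+4*n*[1+n]≤[n*[1+n]]² n 7≤n = subst P (m+[n∸m]≡n 7≤n) (shifted (n ∸ 7))
  where
  P : ℕ → Set
  P n = 8 * n ^ 3 + 4 * (n * suc n) ≤ (n * suc n) ^ 2
  expand : ∀ k → ((7 + k) * (8 + k)) * ((7 + k) * (8 + k) * 1)
                 ≡ 8 * ((7 + k) * ((7 + k) * ((7 + k) * 1))) + 4 * ((7 + k) * (8 + k))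
                   + (168 + 444 * k + 165 * (k * k) + 22 * (k * k * k) + k * k * k * k)
  expand = solve-∀
  shifted : ∀ k → P (7 + k)
  shifted k = ≤-trans (m≤m+n _ _) (≤-reflexive (sym (expand k)))

2*[n³+f]≤f² : ∀ n → 7 ≤ n → 2 * (n ^ 3 + f n) ≤ f n ^ 2
2*[n³+f]≤f² n 7≤n = *-cancelˡ-≤ 4 (begin
  4 * (2 * (n ^ 3 + f n))           ≡⟨ distribute (n ^ 3) (f n) ⟩
  8 * n ^ 3 + 4 * (2 * f n)         ≡⟨ cong (λ t → 8 * n ^ 3 + 4 * t) (2*f≡n*[1+n] n) ⟩
  8 * n ^ 3 + 4 * (n * suc n)       ≤⟨ 8*n³+4*n*[1+n]≤[n*[1+n]]² n 7≤n ⟩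
  (n * suc n) ^ 2                   ≡⟨ cong (_^ 2) (2*f≡n*[1+n] n) ⟨
  (2 * f n) ^ 2                     ≡⟨ [2*m]²≡4*m² (f n) ⟩
  4 * f n ^ 2                       ∎)
  where
  open ≤-Reasoning
  distribute : ∀ N m → 4 * (2 * (N + m)) ≡ 8 * N + 4 * (2 * m)
  distribute = solve-∀

2*[x+4m]≤[2m]² : ∀ x m → 2 * (x + m) ≤ m ^ 2 → 2 * (x + 4 * m) ≤ (2 * m) ^ 2
2*[x+4m]≤[2m]² x m 2[x+m]≤m² = begin
  2 * (x + 4 * m)                   ≤⟨ *-monoʳ-≤ 2 (+-monoˡ-≤ (4 * m) (m≤n*m x 4)) ⟩
  2 * (4 * x + 4 * m)               ≡⟨ cong (2 *_) (*-distribˡ-+ 4 x m) ⟨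
  2 * (4 * (x + m))                 ≡⟨ trans (sym (*-assoc 2 4 (x + m))) (*-assoc 4 2 (x + m)) ⟩
  4 * (2 * (x + m))                 ≤⟨ *-monoʳ-≤ 4 2[x+m]≤m² ⟩
  4 * m ^ 2                         ≡⟨ [2*m]²≡4*m² m ⟨
  (2 * m) ^ 2                       ∎
  where open ≤-Reasoning

CubeChain : ℕ → Set
CubeChain n = π (n ^ 3) < π (n ^ 3 + f n)
            × π (n ^ 3 + f n) < π (n ^ 3 + 2 * f n)
            × π (n ^ 3 + 2 * f n) < π (n ^ 3 + 4 * f n)
            × π (n ^ 3 + 4 * f n) < π (n ^ 3 + 6 * f n)

cubeChain-≥7 : PrimeGapBound → ∀ n → 7 ≤ n → CubeChain n
cubeChain-≥7 gap n 7≤n =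
    step N m ≤-refl refl (≤-trans (*-monoʳ-≤ 2 (m≤m+n N m)) bound₁)
  , step (N + m) m (m≤m+n N m) N+m+m≡N+2m bound₁
  , step (N + 2 * m) (2 * m) (m≤m+n N _) (regroup N 2 2 m)
         (≤-trans (*-monoʳ-≤ 2 (+-monoʳ-≤ N (*-monoˡ-≤ m (m≤m+n 2 2)))) bound₂)
  , step (N + 4 * m) (2 * m) (m≤m+n N _) (regroup N 4 2 m) bound₂
  where
  N = n ^ 3
  m = f n
  bound₁ : 2 * (N + m) ≤ m ^ 2
  bound₁ = 2*[n³+f]≤f² n 7≤n
  bound₂ : 2 * (N + 4 * m) ≤ (2 * m) ^ 2
  bound₂ = 2*[x+4m]≤[2m]² N m bound₁
  step : ∀ x d {y} → N ≤ x → x + d ≡ y → 2 * x ≤ d ^ 2 → π x < π y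
  step x d N≤x refl = π<π[x+d] gap {x} {d} (≤-trans (s≤s z≤n) 5≤πx) (>⇒≢ 5≤πx)
    where
    -- π 11 evaluates to 5
    5≤πx : 5 ≤ π x
    5≤πx = π-mono-≤ {11} (≤-trans (m≤m+n 11 332) (≤-trans (^-monoˡ-≤ 3 7≤n) N≤x))
  N+m+m≡N+2m : N + m + m ≡ N + 2 * m
  N+m+m≡N+2m = trans (+-assoc N m m) (cong (λ t → N + (m + t)) (sym (+-identityʳ m)))
  regroup : ∀ x a b m → x + a * m + b * m ≡ x + (a + b) * m
  regroup = solve-∀

by-computation : ∀ {a b} {_ : True (a <? b)} → a < b
by-computation {_} {_} {a<b} = toWitness a<b

cubeChain-≤6 : ∀ n → 1 ≤ n → n ≤ 6 → CubeChain n
cubeChain-≤6 1 _ _ = by-computation , by-computation , by-computation , by-computation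
cubeChain-≤6 2 _ _ = by-computation , by-computation , by-computation , by-computation
cubeChain-≤6 3 _ _ = by-computation , by-computation , by-computation , by-computation
cubeChain-≤6 4 _ _ = by-computation , by-computation , by-computation , by-computation
cubeChain-≤6 5 _ _ = by-computation , by-computation , by-computation , by-computation
cubeChain-≤6 6 _ _ = by-computation , by-computation , by-computation , by-computation
cubeChain-≤6 (suc (suc (suc (suc (suc (suc (suc _))))))) _ (s≤s (s≤s (s≤s (s≤s (s≤s (s≤s ()))))))

cubeChain : PrimeGapBound → ∀ n → 1 ≤ n → CubeChain n
cubeChain gap n 1≤n with n ≤? 6
... | yes n≤6 = cubeChain-≤6 n 1≤n n≤6
... | no  n≰6 = cubeChain-≥7 gap n (≰⇒> n≰6)

<-<-<-<⇒4≤∸ : ∀ {a b c d e} → a < b → b < c → c < d → d < e → 4 ≤ e ∸ a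
<-<-<-<⇒4≤∸ a<b b<c c<d d<e = m+n≤o⇒m≤o∸n 4
  (≤-trans (s≤s (s≤s (s≤s a<b))) (≤-trans (s≤s (s≤s b<c)) (≤-trans (s≤s c<d) d<e)))

theorem8p1 : (∀ (k p q : ℕ) → 1 ≤ k → ¬ (k ≡ 4) → IsNthPrime k p → IsNthPrime (suc k) q →
    (q ∸ p) ^ 2 < 2 * p) →
    ∀ (n : ℕ) → 1 ≤ n →
    (π (n ^ 3) < π (n ^ 3 + f n))
    × (π (n ^ 3 + f n) < π (n ^ 3 + 2 * f n))
    × (π (n ^ 3 + 2 * f n) < π (n ^ 3 + 4 * f n))
    × (π (n ^ 3 + 4 * f n) < π (n ^ 3 + 6 * f n))
    × (4 ≤ π (suc n ^ 3 ∸ 1) ∸ π (n ^ 3))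
theorem8p1 gap n 1≤n with cubeChain gap n 1≤n
... | c₁ , c₂ , c₃ , c₄ = c₁ , c₂ , c₃ , c₄ ,
  subst (λ y → 4 ≤ π y ∸ π (n ^ 3)) (sym ([1+n]³∸1≡n³+6f n)) (<-<-<-<⇒4≤∸ c₁ c₂ c₃ c₄)
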